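{- Let $n\ge 5$ be an odd integer and $m\ge 2$. Then $g(K_m\boxtimes C_n)=5$ and $h(K_m\boxtimes C_n)=3$.
   Context: $K_m$ is the complete graph of order $m$, $C_n$ the cycle of order $n$. For a connected graph, $I[x,y]$ consists of $x$, $y$ and all vertices on some shortest $x$–$y$ path; $I[S]=\bigcup_{u,v\in S}I[u,v]$; $S$ is geodetic if $I[S]$ is the whole vertex set and $g(\cdot)$ is the minimum size of a geodetic set. $S$ is convex if $I[S]=S$; $CH(S)$ is the smallest convex set containing $S$; $S$ is a hull set if $CH(S)$ is the whole vertex set, and $h(\cdot)$ is the minimum size of a hull set. The strong product $G\boxtimes H$ has vertex set $V(G)\times V(H)$, with $(g,h)$ and $(g',h')$ adjacent whenever ($g=g'$ and $hh'\in E(H)$), or ($h=h'$ and $gg'\in E(G)$), or ($gg'\in E(G)$ and $hh'\in E(H)$). -}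

module Defs where

open import Level using (0ℓ)
open import Data.Nat using (ℕ; zero; suc; _+_; _≤_)
open import Data.Fin using (Fin; toℕ)
open import Data.Product using (Σ; ∃; _×_; _,_)
open import Data.Sum using (_⊎_)
open import Data.List using (List; length)
open import Data.List.Membership.Propositional using (_∈_)
open import Data.List.Relation.Unary.Unique.Propositional using (Unique)
open import Relation.Binary.PropositionalEquality using (_≡_; _≢_)

record Graph : Set₁ where
  field
    V   : Set
    Adj : V → V → Set
open Graph public

K : ℕ → Graph
K m = record { V = Fin m ; Adj = λ i j → i ≢ j }

-- Cycle C_n on vertex set Fin n: i ~ i+1 (indices mod n).
CAdj : (n : ℕ) → Fin n → Fin n → Set
CAdj n a b = (suc (toℕ a) ≡ toℕ b) ⊎ (suc (toℕ b) ≡ toℕ a)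
           ⊎ ((toℕ a ≡ 0) × (suc (toℕ b) ≡ n)) ⊎ ((toℕ b ≡ 0) × (suc (toℕ a) ≡ n))

C : ℕ → Graph
C n = record { V = Fin n ; Adj = CAdj n }

_⊠_ : Graph → Graph → Graph
G ⊠ H = record
  { V   = V G × V H
  ; Adj = λ { (g , h) (g' , h') →
              ((g ≡ g') × Adj H h h')
            ⊎ ((h ≡ h') × Adj G g g')
            ⊎ (Adj G g g' × Adj H h h') } }

module _ (G : Graph) where

  data Walk : V G → V G → ℕ → Set where
    [_]  : (x : V G) → Walk x x 0
    _∷_ : ∀ {x y z k} → Adj G x y → Walk y z k → Walk x z (suc k)

  _OnWalk_ : ∀ {x y k} → V G → Walk x y k → Set
  z OnWalk [ x ] = z ≡ x
  _OnWalk_ {x = x} z (e ∷ w) = (z ≡ x) ⊎ (z OnWalk w)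

  Dist : V G → V G → ℕ → Set
  Dist x y d = Walk x y d × (∀ k → Walk x y k → d ≤ k)

  InInterval : V G → V G → V G → Set
  InInterval x y z = Σ ℕ λ d → Dist x y d × Σ (Walk x y d) λ w → z OnWalk w

  Geodetic : List (V G) → Set
  Geodetic S = ∀ v → Σ (V G) λ u → Σ (V G) λ w → u ∈ S × w ∈ S × InInterval u w v

  Convex : (V G → Set) → Set
  Convex P = ∀ x y z → P x → P y → InInterval x y z → P z

  InHull : List (V G) → V G → Set₁
  InHull S v = (P : V G → Set) → Convex P → (∀ u → u ∈ S → P u) → P v

  HullSet : List (V G) → Set₁
  HullSet S = ∀ v → InHull S v

  -- g(G) = k : minimum size of a geodetic set (sets as duplicate-free lists).
  GeodeticNumber : ℕ → Set
  GeodeticNumber k =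
    (Σ (List (V G)) λ S → Unique S × length S ≡ k × Geodetic S)
    × (∀ S → Unique S → Geodetic S → k ≤ length S)

  HullNumber : ℕ → Set₁
  HullNumber k =
    (Σ (List (V G)) λ S → Unique S × length S ≡ k × HullSet S)
    × (∀ S → Unique S → HullSet S → k ≤ length S)

module Submission where

-- For odd n = 2k+1 ≥ 5 and m ≥ 2, K_m ⊠ C_n has geodetic number 5 and
-- hull number 3.  Everything is read off the projection to the cycle:
-- edges move the position by at most one step, so a vertex strictly inside
-- a geodesic lies over a point strictly between the ends (interval-projects),
-- and conversely vertices over a forward arc of length ≤ k lie on geodesics
-- (on-short-arc).  Upper bounds: the vertices (0, t), t = 0, 1, k, k+1, 2k,
-- are geodetic, and the hull of those for t = 0, k, k+1 contains the rest.
-- Lower bounds: two positions lie in a convex set of C_n missing a position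
-- (pair-blocked), which pulls back to a convex set of the product; and if
-- at most four vertices were geodetic, each position held by just one of
-- them would lie between two others, since its fibre mate must be covered,
-- which Bet-exclusive and four-not-inner rule out.

open import Data.Nat using (ℕ; suc; _*_; _≤_)
open import Data.Product using (∃; _×_)
open import Relation.Binary.PropositionalEquality using (_≡_)

open import Data.Nat using (zero; _+_; _∸_; _⊓_; _<_; z≤n; s≤s; z<s; _≤?_; _<?_; _≟_)
open import Data.Nat.Properties
open import Data.Nat.Tactic.RingSolver using (solve; solve-∀)
open import Data.List using (List; []; _∷_; length)
open import Data.Empty using (⊥; ⊥-elim)
open import Data.Product using (Σ; _,_; proj₁; proj₂)
open import Data.Sum using (_⊎_; inj₁; inj₂)
open import Function using (_∘_)
open import Relation.Nullary using (¬_; Dec; yes; no)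
open import Relation.Binary.Definitions using (tri<; tri≈; tri>)
open import Relation.Binary.PropositionalEquality using (_≢_; refl; sym; trans; cong; cong₂; subst; subst₂)

-- An inequality or a contradiction is
-- obtained by adding hypotheses up (with _⊕_) and checking with the ring
-- solver that the two sides of the sum differ by the claimed amount.

infixl 6 _⊕_
_⊕_ : ∀ {a b c d} → a ≤ b → c ≤ d → a + c ≤ b + d
_⊕_ = +-mono-≤

≡⇒≤ : ∀ {a b} → a ≡ b → a ≤ b
≡⇒≤ = ≤-reflexive

≡⇒≥ : ∀ {a b} → a ≡ b → b ≤ a
≡⇒≥ e = ≤-reflexive (sym e)

absurd-by : ∀ {a b} c → a ≤ b → a ≡ b + suc c → ⊥
absurd-by {a} {b} c h e =
  <-irrefl refl (≤-trans (subst (b <_) (sym e) (≤-trans (s≤s (m≤m+n b c)) (≡⇒≥ (+-suc b c)))) h)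

≤-by : ∀ {p q A B} c → A ≤ B → q + A ≡ p + B + c → p ≤ q
≤-by {p} {q} {A} {B} c h e =
  +-cancelʳ-≤ B p q (≤-trans (m≤m+n (p + B) c) (≤-trans (≡⇒≥ e) (+-monoʳ-≤ q h)))

≡-by : ∀ {p q L R} → L ≡ R → p + R ≡ q + L → p ≡ q
≡-by {p} {q} {L} {R} e i = +-cancelʳ-≡ R p q (trans i (cong (q +_) e))

In4 : {X : Set} → X → X → X → X → X → Set
In4 a b c d z = z ≡ a ⊎ z ≡ b ⊎ z ≡ c ⊎ z ≡ d

module _ {X : Set} {a b c d : X} where
  1st : In4 a b c d a
  1st = inj₁ refl
  2nd : In4 a b c d b
  2nd = inj₂ (inj₁ refl)
  3rd : In4 a b c d c
  3rd = inj₂ (inj₂ (inj₁ refl))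
  4th : In4 a b c d d
  4th = inj₂ (inj₂ (inj₂ refl))

In4-elim : {X : Set} (P : X → Set) {a b c d z : X} → P a → P b → P c → P d → In4 a b c d z → P z
In4-elim P pa pb pc pd (inj₁ refl) = pa
In4-elim P pa pb pc pd (inj₂ (inj₁ refl)) = pb
In4-elim P pa pb pc pd (inj₂ (inj₂ (inj₁ refl))) = pc
In4-elim P pa pb pc pd (inj₂ (inj₂ (inj₂ refl))) = pd

-- Betweenness Bet a b c (b strictly inside a geodesic
-- from a to c) is what intervals of K_m ⊠ C_n project to.

module OddCycle (n k : ℕ) (n≡2k+1 : n ≡ suc (2 * k)) (2≤k : 2 ≤ k) where

  fwd : ℕ → ℕ → ℕ
  fwd a b with a ≤? b
  ... | yes _ = b ∸ a
  ... | no _  = (n ∸ a) + b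

  Fwd : ℕ → ℕ → ℕ → Set
  Fwd f a b = (a ≤ b × f + a ≡ b) ⊎ (b < a × f + a ≡ n + b)

  fwd-Fwd : ∀ {a b} → a < n → b < n → Fwd (fwd a b) a b
  fwd-Fwd {a} {b} a<n b<n with a ≤? b
  ... | yes a≤b = inj₁ (a≤b , m∸n+n≡m a≤b)
  ... | no a≰b = inj₂ (≰⇒> a≰b , trans (reorder (n ∸ a) b a) (cong (_+ b) (m∸n+n≡m (<⇒≤ a<n))))
    where reorder : ∀ x y z → x + y + z ≡ x + z + y
          reorder = solve-∀

  Fwd-< : ∀ {f a b} → b < n → Fwd f a b → f < n
  Fwd-< {f} {a} {b} h (inj₁ (_ , e)) = ≤-by a (h ⊕ ≡⇒≤ e) (solve (a ∷ b ∷ f ∷ n ∷ []))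
  Fwd-< {f} {a} {b} h (inj₂ (h2 , e)) = ≤-by 0 (h2 ⊕ ≡⇒≤ e) (solve (a ∷ b ∷ f ∷ n ∷ []))

  fwd<n : ∀ {a b} → a < n → b < n → fwd a b < n
  fwd<n a<n b<n = Fwd-< b<n (fwd-Fwd a<n b<n)

  fwd-self : ∀ {a} → a < n → fwd a a ≡ 0
  fwd-self {a} a<n with fwd-Fwd a<n a<n
  ... | inj₁ (_ , e) = +-cancelʳ-≡ a _ 0 e
  ... | inj₂ (a<a , _) = ⊥-elim (<-irrefl refl a<a)

  Fwd-0⇒≡ : ∀ {a b} → a < n → Fwd 0 a b → a ≡ b
  Fwd-0⇒≡ _ (inj₁ (_ , e)) = e
  Fwd-0⇒≡ {a} {b} h (inj₂ (_ , e)) = ⊥-elim (absurd-by b (≡⇒≥ e ⊕ h) (solve (a ∷ b ∷ n ∷ [])))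

  fwd≡0⇒≡ : ∀ {a b} → a < n → b < n → fwd a b ≡ 0 → a ≡ b
  fwd≡0⇒≡ a<n b<n e = Fwd-0⇒≡ a<n (subst (λ f → Fwd f _ _) e (fwd-Fwd a<n b<n))

  private
    Fwd-no-wrap : ∀ {f a b} → f + a ≡ b → Fwd f a b
    Fwd-no-wrap {f} {a} e = inj₁ (subst (a ≤_) e (m≤n+m a f) , e)

    Fwd-wrap : ∀ {f a b} → f < n → f + a ≡ n + b → Fwd f a b
    Fwd-wrap {f} {a} {b} hf e = inj₂ (≤-by 0 (≡⇒≥ e ⊕ hf) (solve (f ∷ a ∷ b ∷ n ∷ [])) , e)

  -- Forward steps compose: going from c to x and then from x to y is going
  -- from c to y, so measured from c, the step x → y is fwd x y.
  Fwd-compose : ∀ {f rx ry c x y} → Fwd rx c x → Fwd ry c y → Fwd f x y →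
                f < n → rx < n → ry < n → Fwd f rx ry
  Fwd-compose {f} {rx} {ry} {c} {x} {y} (inj₁ (_ , h1)) (inj₁ (_ , h2)) (inj₁ (_ , h3)) hf hx hy =
    Fwd-no-wrap {f} {rx} {ry} (≡-by (cong₂ _+_ (cong₂ _+_ h1 h3) (sym h2)) (solve (f ∷ rx ∷ ry ∷ c ∷ x ∷ y ∷ n ∷ [])))
  Fwd-compose {f} {rx} {ry} {c} {x} {y} (inj₁ (_ , h1)) (inj₁ (_ , h2)) (inj₂ (_ , h3)) hf hx hy =
    Fwd-wrap {f} {rx} {ry} hf (≡-by (cong₂ _+_ (cong₂ _+_ h1 h3) (sym h2)) (solve (f ∷ rx ∷ ry ∷ c ∷ x ∷ y ∷ n ∷ [])))
  Fwd-compose {f} {rx} {ry} {c} {x} {y} (inj₁ (_ , h1)) (inj₂ (_ , h2)) (inj₁ (_ , h3)) hf hx hy =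
    ⊥-elim (absurd-by (f + rx) (≡⇒≤ h1 ⊕ ≡⇒≥ h2 ⊕ ≡⇒≤ h3 ⊕ hy) (solve (c ∷ f ∷ n ∷ rx ∷ ry ∷ x ∷ y ∷ [])))
  Fwd-compose {f} {rx} {ry} {c} {x} {y} (inj₁ (_ , h1)) (inj₂ (_ , h2)) (inj₂ (_ , h3)) hf hx hy =
    Fwd-no-wrap {f} {rx} {ry} (≡-by (cong₂ _+_ (cong₂ _+_ h1 h3) (sym h2)) (solve (f ∷ rx ∷ ry ∷ c ∷ x ∷ y ∷ n ∷ [])))
  Fwd-compose {f} {rx} {ry} {c} {x} {y} (inj₂ (_ , h1)) (inj₁ (_ , h2)) (inj₁ (_ , h3)) hf hx hy =
    Fwd-wrap {f} {rx} {ry} hf (≡-by (cong₂ _+_ (cong₂ _+_ h1 h3) (sym h2)) (solve (f ∷ rx ∷ ry ∷ c ∷ x ∷ y ∷ n ∷ [])))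
  Fwd-compose {f} {rx} {ry} {c} {x} {y} (inj₂ (_ , h1)) (inj₁ (_ , h2)) (inj₂ (_ , h3)) hf hx hy =
    ⊥-elim (absurd-by (1 + ry) (≡⇒≥ h1 ⊕ ≡⇒≤ h2 ⊕ ≡⇒≥ h3 ⊕ hf ⊕ hx) (solve (c ∷ f ∷ n ∷ rx ∷ ry ∷ x ∷ y ∷ [])))
  Fwd-compose {f} {rx} {ry} {c} {x} {y} (inj₂ (_ , h1)) (inj₂ (_ , h2)) (inj₁ (_ , h3)) hf hx hy =
    Fwd-no-wrap {f} {rx} {ry} (≡-by (cong₂ _+_ (cong₂ _+_ h1 h3) (sym h2)) (solve (f ∷ rx ∷ ry ∷ c ∷ x ∷ y ∷ n ∷ [])))
  Fwd-compose {f} {rx} {ry} {c} {x} {y} (inj₂ (_ , h1)) (inj₂ (_ , h2)) (inj₂ (_ , h3)) hf hx hy =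
    Fwd-wrap {f} {rx} {ry} hf (≡-by (cong₂ _+_ (cong₂ _+_ h1 h3) (sym h2)) (solve (f ∷ rx ∷ ry ∷ c ∷ x ∷ y ∷ n ∷ [])))

  fwd-compose : ∀ {c x y} → c < n → x < n → y < n → Fwd (fwd x y) (fwd c x) (fwd c y)
  fwd-compose hc hx hy =
    Fwd-compose (fwd-Fwd hc hx) (fwd-Fwd hc hy) (fwd-Fwd hx hy) (fwd<n hx hy) (fwd<n hc hx) (fwd<n hc hy)

  fwd-injective : ∀ {c x y} → c < n → x < n → y < n → fwd c x ≡ fwd c y → x ≡ y
  fwd-injective {c} {x} {y} hc hx hy eq with fwd-compose hc hx hy
  ... | inj₁ (_ , e) = fwd≡0⇒≡ hx hy (+-cancelʳ-≡ (fwd c x) (fwd x y) 0 (trans e (sym eq)))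
  ... | inj₂ (lt , _) = ⊥-elim (<-irrefl (sym eq) lt)

  fwd+fwd≡n : ∀ {a b} → a < n → b < n → a ≢ b → fwd a b + fwd b a ≡ n
  fwd+fwd≡n {a} {b} ha hb a≢b with subst (Fwd (fwd b a) (fwd a b)) (fwd-self ha) (fwd-compose ha hb ha)
  ... | inj₁ (le , _) = ⊥-elim (a≢b (fwd≡0⇒≡ ha hb (n≤0⇒n≡0 le)))
  ... | inj₂ (_ , e) = trans (+-comm (fwd a b) (fwd b a)) (trans e (+-identityʳ n))

  fwd-pos : ∀ {a b} → a < n → b < n → a ≢ b → 1 ≤ fwd a b
  fwd-pos ha hb a≢b = n≢0⇒n>0 (a≢b ∘ fwd≡0⇒≡ ha hb)

  fwd-up : ∀ {a b} → a ≤ b → b < n → fwd a b + a ≡ b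
  fwd-up a≤b hb with fwd-Fwd (≤-<-trans a≤b hb) hb
  ... | inj₁ (_ , e) = e
  ... | inj₂ (b<a , _) = ⊥-elim (<⇒≱ b<a a≤b)

  fwd-down : ∀ {a b} → b < a → a < n → fwd a b + a ≡ n + b
  fwd-down b<a ha with fwd-Fwd ha (<-trans b<a ha)
  ... | inj₁ (a≤b , _) = ⊥-elim (<⇒≱ b<a a≤b)
  ... | inj₂ (_ , e) = e

  next : ℕ → ℕ
  next a with suc a ≟ n
  ... | yes _ = 0
  ... | no _ = suc a

  next<n : ∀ {a} → a < n → next a < n
  next<n {a} h with suc a ≟ n
  ... | yes e = subst (0 <_) e z<s
  ... | no ne = ≤∧≢⇒< h ne

  next-cases : ∀ a → (suc a ≡ n × next a ≡ 0) ⊎ (suc a ≢ n × next a ≡ suc a)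
  next-cases a with suc a ≟ n
  ... | yes e = inj₁ (e , refl)
  ... | no ne = inj₂ (ne , refl)

  fwd-next : ∀ {a} → a < n → fwd a (next a) ≡ 1
  fwd-next {a} h with next-cases a
  ... | inj₁ (sa≡n , e) rewrite e = last-step (fwd-down 0<a h)
    where
    0<a : 0 < a
    0<a = ≤-by (suc k) (≡⇒≥ sa≡n ⊕ ≡⇒≥ n≡2k+1 ⊕ 2≤k) (solve (a ∷ k ∷ n ∷ []))
    last-step : ∀ {f} → f + a ≡ n + 0 → f ≡ 1
    last-step {f} e = ≤-antisym (≤-by 0 (≡⇒≤ e ⊕ ≡⇒≥ sa≡n) (solve (a ∷ f ∷ n ∷ [])))
                                (≤-by 0 (≡⇒≥ e ⊕ ≡⇒≤ sa≡n) (solve (a ∷ f ∷ n ∷ [])))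
  ... | inj₂ (sa≢n , e) rewrite e = +-cancelʳ-≡ a _ 1 (fwd-up (n≤1+n a) (≤∧≢⇒< h sa≢n))

  next≢ : ∀ {a} → a < n → next a ≢ a
  next≢ {a} h e = 0≢1+n (trans (sym (fwd-self h)) (trans (cong (fwd a) (sym e)) (fwd-next h)))

  fwd-from-next : ∀ {a c} → a < n → c < n → a ≢ c → fwd a c ≡ suc (fwd (next a) c)
  fwd-from-next {a} {c} ha hc a≢c
    with subst (λ f → Fwd (fwd (next a) c) f (fwd a c)) (fwd-next ha) (fwd-compose ha (next<n ha) hc)
  ... | inj₁ (_ , e) = trans (sym e) (+-comm (fwd (next a) c) 1)
  ... | inj₂ (lt , _) = ⊥-elim (a≢c (fwd≡0⇒≡ ha hc (n≤0⇒n≡0 (≤-pred lt))))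

  fwd-to-next : ∀ {a c} → a < n → c < n → next a ≢ c → fwd c (next a) ≡ suc (fwd c a)
  fwd-to-next {a} {c} ha hc na≢c
    with subst (λ f → Fwd f (fwd c a) (fwd c (next a))) (fwd-next ha) (fwd-compose hc ha (next<n ha))
  ... | inj₁ (_ , e) = sym e
  ... | inj₂ (_ , e) = ⊥-elim (na≢c (sym (fwd≡0⇒≡ hc (next<n ha) (n≤0⇒n≡0 (no-wrap e (fwd<n hc ha))))))
    where no-wrap : ∀ {r r'} → 1 + r ≡ n + r' → r < n → r' ≤ 0
          no-wrap {r} {r'} e h = ≤-by 0 (≡⇒≥ e ⊕ h) (solve (n ∷ r ∷ r' ∷ []))

  advance : ℕ → ℕ → ℕ
  advance a zero = a
  advance a (suc t) = next (advance a t)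

  advance<n : ∀ {a} t → a < n → advance a t < n
  advance<n zero h = h
  advance<n (suc t) h = next<n (advance<n t h)

  fwd-advance : ∀ {a} t → a < n → t < n → fwd a (advance a t) ≡ t
  fwd-advance zero h _ = fwd-self h
  fwd-advance {a} (suc t) h ht
    with subst (λ f → Fwd f (fwd a (advance a t)) (fwd a (next (advance a t))))
               (fwd-next (advance<n t h)) (fwd-compose h (advance<n t h) (next<n (advance<n t h)))
  ... | inj₁ (_ , e) = trans (sym e) (cong suc (fwd-advance t h (<-trans (n<1+n t) ht)))
  ... | inj₂ (_ , e) = ⊥-elim (no-wrap e (fwd-advance t h (<-trans (n<1+n t) ht)))
    where no-wrap : ∀ {r r'} → 1 + r ≡ n + r' → r ≡ t → ⊥
          no-wrap {r} {r'} e r≡t = absurd-by r' (≡⇒≥ e ⊕ ≡⇒≤ r≡t ⊕ ht) (solve (n ∷ r ∷ r' ∷ t ∷ []))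

  cdist : ℕ → ℕ → ℕ
  cdist a b = fwd a b ⊓ fwd b a

  cdist-self : ∀ {a} → a < n → cdist a a ≡ 0
  cdist-self h rewrite fwd-self h = refl

  cdist-sym : ∀ a b → cdist a b ≡ cdist b a
  cdist-sym a b = ⊓-comm (fwd a b) (fwd b a)

  cdist-pos : ∀ {a b} → a < n → b < n → a ≢ b → 1 ≤ cdist a b
  cdist-pos ha hb a≢b = ⊓-glb (fwd-pos ha hb a≢b) (fwd-pos hb ha (a≢b ∘ sym))

  cdist≤fwd : ∀ a b → cdist a b ≤ fwd a b
  cdist≤fwd a b = m⊓n≤m _ _

  cdist≤bwd : ∀ a b → cdist a b ≤ fwd b a
  cdist≤bwd a b = m⊓n≤n _ _

  cdist-next : ∀ {a c} → a < n → c < n → (cdist (next a) c ≤ suc (cdist a c)) × (cdist a c ≤ suc (cdist (next a) c))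
  cdist-next {a} {c} ha hc with a ≟ c | next a ≟ c
  ... | yes refl | _ = ≤-trans (cdist≤bwd (next a) a) (≤-trans (≡⇒≤ (fwd-next ha)) (s≤s z≤n)) , ≤-trans (≡⇒≤ (cdist-self ha)) z≤n
  ... | no _ | yes refl = ≤-trans (≡⇒≤ (cdist-self (next<n ha))) z≤n , ≤-trans (cdist≤fwd a (next a)) (≤-trans (≡⇒≤ (fwd-next ha)) (s≤s z≤n))
  ... | no a≢c | no na≢c rewrite fwd-from-next ha hc a≢c | fwd-to-next ha hc na≢c =
    ⊓-mono-≤ (≤-trans (n≤1+n _) (n≤1+n _)) ≤-refl , ⊓-mono-≤ ≤-refl (≤-trans (n≤1+n _) (n≤1+n _))

  private
    wraps-past-k : ∀ {A B C} → A + B ≡ n + C → B + A ≤ k → ⊥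
    wraps-past-k {A} {B} {C} e h = absurd-by (C + k) (≡⇒≥ e ⊕ h ⊕ ≡⇒≥ n≡2k+1) (solve (A ∷ B ∷ C ∷ k ∷ n ∷ []))
    way-back-longer : ∀ {S F B} → S ≤ k → F ≡ S → F + B ≡ n → S ≤ B
    way-back-longer {S} {F} {B} h e₁ e₂ =
      ≤-by 1 (h ⊕ h ⊕ ≡⇒≤ e₁ ⊕ ≡⇒≥ n≡2k+1 ⊕ ≡⇒≥ e₂) (solve (B ∷ F ∷ S ∷ k ∷ n ∷ []))

  short-arc : ∀ {u v w} → u < n → v < n → w < n → u ≢ v →
              fwd u v + fwd v w ≤ k → fwd u v + fwd v w ≤ cdist u w
  short-arc {u} {v} {w} hu hv hw u≢v short with fwd-compose hu hv hw
  ... | inj₂ (_ , e) = ⊥-elim (wraps-past-k {fwd v w} {fwd u v} e short)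
  ... | inj₁ (_ , e) = ⊓-glb (≡⇒≤ S≡F) (way-back-longer short (sym S≡F) (fwd+fwd≡n hu hw u≢w))
    where
    S≡F : fwd u v + fwd v w ≡ fwd u w
    S≡F = trans (+-comm (fwd u v) _) e
    u≢w : u ≢ w
    u≢w refl = <⇒≱ (fwd-pos hu hv u≢v) (≤-trans (m≤m+n _ _) (≤-trans (≡⇒≤ S≡F) (≡⇒≤ (fwd-self hu))))

  private
    route : ∀ {A B a b e} → A + a ≡ b → B + b ≡ e → e ≤ k + a → A + B ≤ k
    route {A} {B} {a} {b} {e} e₁ e₂ h = ≤-by 0 (≡⇒≤ e₁ ⊕ ≡⇒≤ e₂ ⊕ h) (solve (A ∷ B ∷ a ∷ b ∷ e ∷ k ∷ []))
    route-wrapped : ∀ {A B a b c} → A + a ≡ n + b → B + b ≡ c → n + c ≤ k + a → A + B ≤ k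
    route-wrapped {A} {B} {a} {b} {c} e₁ e₂ h = ≤-by 0 (≡⇒≤ e₁ ⊕ ≡⇒≤ e₂ ⊕ h) (solve (A ∷ B ∷ a ∷ b ∷ c ∷ k ∷ n ∷ []))

  route-inside : ∀ {a v c} → a < v → v < c → c < n → c ≤ k + a → fwd a v + fwd v c ≤ k
  route-inside a<v v<c c<n c≤ = route (fwd-up (<⇒≤ a<v) (<-trans v<c c<n)) (fwd-up (<⇒≤ v<c) c<n) c≤

  route-wrap-after : ∀ {a v c} → c < a → a < v → v < n → n + c ≤ k + a → fwd a v + fwd v c ≤ k
  route-wrap-after c<a a<v v<n far = route (fwd-up (<⇒≤ a<v) v<n) (fwd-down (<-trans c<a a<v) v<n) far

  route-wrap-before : ∀ {a v c} → v < c → c < a → a < n → n + c ≤ k + a → fwd a v + fwd v c ≤ k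
  route-wrap-before v<c c<a a<n far = route-wrapped (fwd-down (<-trans v<c c<a) a<n) (fwd-up (<⇒≤ v<c) (<-trans c<a a<n)) far

  -- The landmark positions 0 < 1 < k < k+1 < 2k < n of the explicit
  -- geodetic and hull sets, and the two wrapping arcs they use.
  k+1<2k : suc k < 2 * k
  k+1<2k = ≤-by 0 2≤k (solve (k ∷ []))

  k<2k : k < 2 * k
  k<2k = <-trans (n<1+n k) k+1<2k

  2k<n : 2 * k < n
  2k<n = ≤-reflexive (sym n≡2k+1)

  k+1<n : suc k < n
  k+1<n = <-trans k+1<2k 2k<n

  k<n : k < n
  k<n = <-trans (n<1+n k) k+1<n

  1<n : 1 < n
  1<n = <-trans 2≤k k<n

  wrap-to-1 : n + 1 ≤ k + 2 * k
  wrap-to-1 = ≤-by 0 (≡⇒≤ n≡2k+1 ⊕ 2≤k) (solve (k ∷ n ∷ []))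

  wrap-to-0 : n + 0 ≤ k + suc k
  wrap-to-0 = ≤-by 0 (≡⇒≤ n≡2k+1) (solve (k ∷ n ∷ []))

  Bet : ℕ → ℕ → ℕ → Set
  Bet a b c = (a ≢ b) × (b ≢ c) × (cdist a b + cdist b c ≤ cdist a c)

  Bet-swap : ∀ {a b c} → Bet a b c → Bet c b a
  Bet-swap {a} {b} {c} (a≢b , b≢c , h) =
    (b≢c ∘ sym) , (a≢b ∘ sym) ,
    subst₂ _≤_ (trans (+-comm (cdist a b) (cdist b c)) (cong₂ _+_ (cdist-sym b c) (cdist-sym a b))) (cdist-sym a c) h

  ¬Bet-return : ∀ {a d} → a < n → d < n → ¬ Bet a d a
  ¬Bet-return {a} {d} ha hd (a≢d , d≢a , h) = no-detour (cdist-pos hd ha d≢a) h (cdist-self ha)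
    where no-detour : ∀ {x y z} → 1 ≤ y → x + y ≤ z → z ≡ 0 → ⊥
          no-detour {x} {y} {z} y≥1 h z≡0 = absurd-by x (y≥1 ⊕ h ⊕ ≡⇒≤ z≡0) (solve (x ∷ y ∷ z ∷ []))

  private
    opposite-arith : ∀ {A U B W D du dw} → A + U ≡ n → B + W ≡ n → D + U ≡ W → 1 ≤ U → W < n →
      suc (k + W) ≤ n + U → du + dw ≤ D → (du ≡ A ⊎ du ≡ U) → (dw ≡ W ⊎ dw ≡ B) → ⊥
    opposite-arith {A} {U} {B} {W} {D} eA eB e U≥1 W<n far h (inj₂ refl) (inj₁ refl) =
      absurd-by U (h ⊕ ≡⇒≤ e ⊕ U≥1) (solve (D ∷ U ∷ W ∷ []))
    opposite-arith {A} {U} {B} {W} {D} eA eB e U≥1 W<n far h (inj₂ refl) (inj₂ refl) =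
      absurd-by 0 (h ⊕ ≡⇒≤ e ⊕ ≡⇒≥ eB ⊕ far ⊕ far ⊕ ≡⇒≤ n≡2k+1) (solve (B ∷ D ∷ U ∷ W ∷ k ∷ n ∷ []))
    opposite-arith {A} {U} {B} {W} {D} eA eB e U≥1 W<n far h (inj₁ refl) (inj₁ refl) =
      absurd-by (2 * k) (h ⊕ ≡⇒≤ e ⊕ ≡⇒≥ eA ⊕ ≡⇒≥ n≡2k+1) (solve (A ∷ D ∷ U ∷ W ∷ k ∷ n ∷ []))
    opposite-arith {A} {U} {B} {W} {D} eA eB e U≥1 W<n far h (inj₁ refl) (inj₂ refl) =
      absurd-by B (h ⊕ ≡⇒≤ e ⊕ ≡⇒≥ eA ⊕ W<n) (solve (A ∷ B ∷ D ∷ U ∷ W ∷ n ∷ []))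

  -- If p lies strictly between u and w, the forward distances from p to
  -- u and to w differ by more than k: a geodesic through p leaves it in
  -- the two opposite directions.
  Bet-gap : ∀ {u p w} → u < n → p < n → w < n → Bet u p w → fwd p u < fwd p w →
            n + fwd p u ≤ k + fwd p w
  Bet-gap {u} {p} {w} hu hp hw (u≢p , p≢w , h) lt with n + fwd p u ≤? k + fwd p w
  ... | yes far = far
  ... | no near with fwd-compose hp hu hw
  ...   | inj₂ (gt , _) = ⊥-elim (<-asym lt gt)
  ...   | inj₁ (_ , e) =
    ⊥-elim (opposite-arith (fwd+fwd≡n hu hp u≢p) (fwd+fwd≡n hw hp (p≢w ∘ sym)) e (fwd-pos hp hu (u≢p ∘ sym))
             (fwd<n hp hw) (≰⇒> near) (≤-trans h (cdist≤fwd u w))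
             (⊓-sel (fwd u p) (fwd p u)) (⊓-sel (fwd p w) (fwd w p)))

  Bet-opposite : ∀ {u p w} → u < n → p < n → w < n → Bet u p w →
                 (n + fwd p w ≤ k + fwd p u) ⊎ (n + fwd p u ≤ k + fwd p w)
  Bet-opposite {u} {p} {w} hu hp hw bt with <-cmp (fwd p u) (fwd p w)
  ... | tri< lt _ _ = inj₂ (Bet-gap hu hp hw bt lt)
  ... | tri> _ _ gt = inj₁ (Bet-gap hw hp hu (Bet-swap bt) gt)
  ... | tri≈ _ eq _ rewrite fwd-injective hp hu hw eq = ⊥-elim (¬Bet-return hw hp bt)

  -- Sets of positions closed under betweenness (the convex sets of C_n).
  BetClosed : (ℕ → Set) → Set
  BetClosed Q = ∀ {x z y} → x < n → z < n → y < n → Q x → Q y → Bet x z y → Q z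

  Arc : ℕ → ℕ → ℕ → Set
  Arc a l z = fwd a z ≤ l

  private
    arc-too-long : ∀ {F₁ F₂ r r₁ r₂ l} → n + F₁ ≤ k + F₂ → F₁ + r ≡ n + r₁ → F₂ + r ≡ n + r₂ →
                   r₂ ≤ l → l ≤ k → ⊥
    arc-too-long {F₁} {F₂} {r} {r₁} {r₂} {l} gap e₁ e₂ r₂≤l l≤k =
      absurd-by r₁ (gap ⊕ ≡⇒≥ e₁ ⊕ ≡⇒≤ e₂ ⊕ r₂≤l ⊕ l≤k ⊕ ≡⇒≥ n≡2k+1)
                (solve (F₁ ∷ F₂ ∷ k ∷ l ∷ n ∷ r ∷ r₁ ∷ r₂ ∷ []))

  -- Arcs shorter than half the cycle are convex: from inside the arc, the
  -- two ends of a geodesic through a point outside it would have to lie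
  -- more than half a turn apart.
  arc-closed : ∀ {a l} → a < n → l ≤ k → BetClosed (Arc a l)
  arc-closed {a} {l} ha l≤k {x} {z} {y} hx hz hy x∈ y∈ bt with fwd-compose ha hz hx | fwd-compose ha hz hy
  ... | inj₁ (le , _) | _ = ≤-trans le x∈
  ... | inj₂ _ | inj₁ (le , _) = ≤-trans le y∈
  ... | inj₂ (_ , ex) | inj₂ (_ , ey) with Bet-opposite hx hz hy bt
  ...   | inj₁ gap = ⊥-elim (arc-too-long gap ey ex x∈ l≤k)
  ...   | inj₂ gap = ⊥-elim (arc-too-long gap ex ey y∈ l≤k)

  arc-escape : ∀ {a l} → a < n → l ≤ k → advance a (suc l) < n × ¬ Arc a l (advance a (suc l))
  arc-escape {a} {l} ha l≤k =
    advance<n (suc l) ha , λ h → 1+n≰n (≤-trans (≡⇒≥ (fwd-advance (suc l) ha 2+l≤n)) h)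
    where 2+l≤n : suc l < n
          2+l≤n = ≤-by 1 (l≤k ⊕ ≡⇒≥ n≡2k+1 ⊕ 2≤k) (solve (k ∷ l ∷ n ∷ []))

  Blocking : ℕ → ℕ → Set₁
  Blocking a b = Σ (ℕ → Set) λ Q → BetClosed Q × Q a × Q b × Σ ℕ λ d → d < n × ¬ Q d

  arc-blocked : ∀ {a b} → a < n → fwd a b ≤ k → Blocking a b
  arc-blocked {a} {b} ha short =
    Arc a (fwd a b) , arc-closed ha short , ≤-trans (≡⇒≤ (fwd-self ha)) z≤n , ≤-refl , _ , arc-escape ha short

  -- Two positions never generate C_n: a single position is convex, and two
  -- distinct ones lie on a common arc of length at most k.
  pair-blocked : ∀ {a b} → a < n → b < n → Blocking a b
  pair-blocked {a} {b} ha hb with a ≟ b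
  ... | yes refl = (_≡ a) , point-closed , refl , refl , next a , next<n ha , next≢ ha
    where point-closed : BetClosed (_≡ a)
          point-closed hx hz hy refl refl bt = ⊥-elim (¬Bet-return hx hz bt)
  ... | no a≢b with fwd a b ≤? k
  ...   | yes short = arc-blocked ha short
  ...   | no long with arc-blocked hb (other-short (fwd+fwd≡n ha hb a≢b) long)
    where
    other-short : ∀ {l l'} → l + l' ≡ n → ¬ l ≤ k → l' ≤ k
    other-short {l} {l'} e long = ≤-by 0 (≡⇒≤ e ⊕ ≡⇒≤ n≡2k+1 ⊕ ≰⇒> long) (solve (k ∷ l ∷ l' ∷ n ∷ []))
  ...     | Q , closed , Qb , Qa , missed = Q , closed , Qa , Qb , missed

  Inner : (ℕ → Set) → ℕ → Set
  Inner A c = Σ ℕ λ u → Σ ℕ λ w → A u × A w × Bet u c w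

  inner-of-three : ∀ {A s t z} → s < n → t < n → z < n →
    (∀ {u} → A u → u ≡ s ⊎ u ≡ t ⊎ u ≡ z) → Inner A z → Bet s z t
  inner-of-three {A} {s} {t} {z} hs ht hz A⊆ (u , w , Au , Aw , bt) = pick (A⊆ Au) (A⊆ Aw) bt
    where
    pick : ∀ {u w} → u ≡ s ⊎ u ≡ t ⊎ u ≡ z → w ≡ s ⊎ w ≡ t ⊎ w ≡ z → Bet u z w → Bet s z t
    pick _ (inj₂ (inj₂ refl)) (_ , z≢z , _) = ⊥-elim (z≢z refl)
    pick (inj₂ (inj₂ refl)) _ (z≢z , _ , _) = ⊥-elim (z≢z refl)
    pick (inj₁ refl) (inj₁ refl) bt = ⊥-elim (¬Bet-return hs hz bt)
    pick (inj₂ (inj₁ refl)) (inj₂ (inj₁ refl)) bt = ⊥-elim (¬Bet-return ht hz bt)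
    pick (inj₁ refl) (inj₂ (inj₁ refl)) bt = bt
    pick (inj₂ (inj₁ refl)) (inj₁ refl) bt = Bet-swap bt

  Bet-exclusive : ∀ {a b c} → b < n → c < n → Bet a b c → Bet a c b → ⊥
  Bet-exclusive hb hc (_ , b≢c , h₁) (_ , _ , h₂) = both-ways h₁ h₂ (cdist-pos hb hc b≢c)
    where both-ways : ∀ {X Y Y' Z} → X + Y ≤ Z → Z + Y' ≤ X → 1 ≤ Y → ⊥
          both-ways {X} {Y} {Y'} {Z} h₁ h₂ Y≥1 = absurd-by Y' (h₁ ⊕ h₂ ⊕ Y≥1) (solve (X ∷ Y ∷ Y' ∷ Z ∷ []))

  private
    spread : ∀ {F F' s lo hi} → n + F' ≤ k + F → lo ≤ F' + s → F + s ≤ hi → n + lo ≤ k + hi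
    spread {F} {F'} {s} {lo} {hi} h₁ h₂ h₃ = ≤-by 0 (h₁ ⊕ h₂ ⊕ h₃) (solve (F ∷ F' ∷ k ∷ n ∷ s ∷ lo ∷ hi ∷ []))
    two-gaps : ∀ {x y} → n + x ≤ k + y → n + y ≤ k + (n + x) → ⊥
    two-gaps {x} {y} h₁ h₂ = absurd-by 0 (h₁ ⊕ h₂ ⊕ ≡⇒≥ n≡2k+1) (solve (k ∷ n ∷ x ∷ y ∷ []))
    below : ∀ {s x y} → s ≡ n + y → x < n → x ≤ s
    below {s} {x} {y} e x<n = ≤-by (1 + y) (≡⇒≥ e ⊕ x<n) (solve (n ∷ s ∷ x ∷ y ∷ []))
    above : ∀ {s x y} → s ≡ x → x < n → s ≤ n + y
    above {s} {x} {y} e x<n = ≤-by (1 + y) (≡⇒≤ e ⊕ x<n) (solve (n ∷ s ∷ x ∷ y ∷ []))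

  -- An inner point p sees the other members spread over more than k steps:
  -- if their forward distances from p, shifted by s, all lie in [lo, hi],
  -- then hi exceeds lo by more than k (by Bet-opposite).
  inner-spread : ∀ {A p s lo hi} → p < n → (∀ {z} → A z → z < n) →
    (∀ {z} → A z → z ≢ p → lo ≤ fwd p z + s × fwd p z + s ≤ hi) → Inner A p → n + lo ≤ k + hi
  inner-spread hp bound window (u , w , Au , Aw , bt@(u≢p , p≢w , _)) with Bet-opposite (bound Au) hp (bound Aw) bt
  ... | inj₁ gap = spread gap (proj₁ (window Aw (p≢w ∘ sym))) (proj₂ (window Au u≢p))
  ... | inj₂ gap = spread gap (proj₁ (window Au u≢p)) (proj₂ (window Aw (p≢w ∘ sym)))

  -- Seen from a the others spread from b
  -- to d, and seen from c they spread from d round to b; both spreads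
  -- exceeding k is more than the whole cycle.
  sorted-four : ∀ {A a b c d} → a < n → b < n → c < n → d < n →
    fwd a b < fwd a c → fwd a c < fwd a d →
    (∀ {z} → A z → In4 a b c d z) → Inner A a → Inner A c → ⊥
  sorted-four {A} {a} {b} {c} {d} ha hb hc hd b<c c<d A⊆ inner-a inner-c =
    two-gaps (inner-spread ha bound window-a inner-a) (inner-spread hc bound window-c inner-c)
    where
    bound : ∀ {z} → A z → z < n
    bound = In4-elim (_< n) ha hb hc hd ∘ A⊆
    window-a : ∀ {z} → A z → z ≢ a → fwd a b ≤ fwd a z + 0 × fwd a z + 0 ≤ fwd a d
    window-a {z} Az z≢a rewrite +-identityʳ (fwd a z) with A⊆ Az
    ... | inj₁ refl = ⊥-elim (z≢a refl)
    ... | inj₂ (inj₁ refl) = ≤-refl , <⇒≤ (<-trans b<c c<d)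
    ... | inj₂ (inj₂ (inj₁ refl)) = <⇒≤ b<c , <⇒≤ c<d
    ... | inj₂ (inj₂ (inj₂ refl)) = <⇒≤ (<-trans b<c c<d) , ≤-refl
    window-c : ∀ {z} → A z → z ≢ c → fwd a d ≤ fwd c z + fwd a c × fwd c z + fwd a c ≤ n + fwd a b
    window-c Az z≢c with A⊆ Az
    ... | inj₂ (inj₂ (inj₁ refl)) = ⊥-elim (z≢c refl)
    ... | inj₁ refl with subst (Fwd (fwd c a) (fwd a c)) (fwd-self ha) (fwd-compose ha hc ha)
    ...   | inj₁ (c≤0 , _) = ⊥-elim (<-irrefl refl (<-≤-trans (≤-<-trans z≤n b<c) c≤0))
    ...   | inj₂ (_ , e) = below e (fwd<n ha hd) , ≤-trans (≡⇒≤ e) (+-monoʳ-≤ n z≤n)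
    window-c Az z≢c | inj₂ (inj₁ refl) with fwd-compose ha hc hb
    ...   | inj₁ (c≤b , _) = ⊥-elim (<⇒≱ b<c c≤b)
    ...   | inj₂ (_ , e) = below e (fwd<n ha hd) , ≡⇒≤ e
    window-c Az z≢c | inj₂ (inj₂ (inj₂ refl)) with fwd-compose ha hc hd
    ...   | inj₁ (_ , e) = ≡⇒≥ e , above e (fwd<n ha hd)
    ...   | inj₂ (d<c , _) = ⊥-elim (<-asym d<c c<d)

  four-not-inner : ∀ {A a b c d} → a < n → b < n → c < n → d < n → b ≢ c → b ≢ d → c ≢ d →
    (∀ {z} → A z → In4 a b c d z) → Inner A a → Inner A b → Inner A c → Inner A d → ⊥
  four-not-inner {A} {a} {b} {c} {d} ha hb hc hd b≢c b≢d c≢d A⊆ ia ib ic id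
    with <-cmp (fwd a b) (fwd a c) | <-cmp (fwd a c) (fwd a d) | <-cmp (fwd a b) (fwd a d)
  ... | tri≈ _ e _ | _ | _ = b≢c (fwd-injective ha hb hc e)
  ... | _ | tri≈ _ e _ | _ = c≢d (fwd-injective ha hc hd e)
  ... | tri< bc _ _ | tri< cd _ _ | _ = sorted-four ha hb hc hd bc cd A⊆ ia ic
  ... | tri> _ _ cb | tri> _ _ dc | _ =
    sorted-four ha hd hc hb dc cb (In4-elim (In4 _ _ _ _) 1st 4th 3rd 2nd ∘ A⊆) ia ic
  ... | _ | _ | tri≈ _ e _ = b≢d (fwd-injective ha hb hd e)
  ... | tri< bc _ _ | tri> _ _ dc | tri< bd _ _ =
    sorted-four ha hb hd hc bd dc (In4-elim (In4 _ _ _ _) 1st 2nd 4th 3rd ∘ A⊆) ia id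
  ... | tri< bc _ _ | tri> _ _ dc | tri> _ _ db =
    sorted-four ha hd hb hc db bc (In4-elim (In4 _ _ _ _) 1st 3rd 4th 2nd ∘ A⊆) ia ib
  ... | tri> _ _ cb | tri< cd _ _ | tri< bd _ _ =
    sorted-four ha hc hb hd cb bd (In4-elim (In4 _ _ _ _) 1st 3rd 2nd 4th ∘ A⊆) ia ib
  ... | tri> _ _ cb | tri< cd _ _ | tri> _ _ db =
    sorted-four ha hc hd hb cd db (In4-elim (In4 _ _ _ _) 1st 4th 2nd 3rd ∘ A⊆) ia id


-- Graphs.  (These modules are opened only here: their constructors _∷_
-- (walks, All, AllPairs) would make the variable lists passed to the ring
-- solver in OddCycle ambiguous, which slows checking down drastically.)
open import Defs
open import Data.Fin using (Fin; toℕ; fromℕ<) renaming (zero to fzero; suc to fsuc)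
import Data.Fin.Properties as FinProps
open import Data.List.Membership.Propositional using (_∈_)
open import Data.List.Relation.Unary.Any using (here; there)
open import Data.List.Relation.Unary.All using ([]; _∷_)
open import Data.List.Relation.Unary.AllPairs using ([]; _∷_)
open import Data.List.Relation.Unary.Unique.Propositional using (Unique)
open import Data.Product.Properties using (≡-dec)

module Walks (G : Graph) where

  _++_ : ∀ {x y z a b} → Walk G x y a → Walk G y z b → Walk G x z (a + b)
  [ x ] ++ w = w
  (e ∷ w₁) ++ w₂ = e ∷ (w₁ ++ w₂)

  on-start : ∀ {x y L} (w : Walk G x y L) → _OnWalk_ G x w
  on-start [ x ] = refl
  on-start (e ∷ w) = inj₁ refl

  on-junction : ∀ {x y z a b} (w₁ : Walk G x y a) (w₂ : Walk G y z b) → _OnWalk_ G y (w₁ ++ w₂)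
  on-junction [ x ] w₂ = on-start w₂
  on-junction (e ∷ w₁) w₂ = inj₂ (on-junction w₁ w₂)

  split : ∀ {x y d v} (w : Walk G x y d) → _OnWalk_ G v w →
          Σ ℕ λ L₁ → Σ ℕ λ L₂ → (L₁ + L₂ ≡ d) × Walk G x v L₁ × Walk G v y L₂
  split [ x ] refl = 0 , 0 , refl , [ x ] , [ x ]
  split (e ∷ w) (inj₁ refl) = 0 , _ , refl , [ _ ] , e ∷ w
  split (e ∷ w) (inj₂ v∈w) with split w v∈w
  ... | L₁ , L₂ , eq , w₁ , w₂ = suc L₁ , L₂ , cong suc eq , e ∷ w₁ , w₂

  walk-pos : ∀ {x y L} → Walk G x y L → x ≢ y → 1 ≤ L
  walk-pos [ x ] x≢x = ⊥-elim (x≢x refl)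
  walk-pos (e ∷ w) _ = s≤s z≤n

  module _ (adj-sym : ∀ {x y} → Adj G x y → Adj G y x) where

    reverse : ∀ {a b L} → Walk G a b L → Walk G b a L
    reverse w = subst (Walk G _ _) (+-identityʳ _) (go w [ _ ])
      where
      go : ∀ {a b c L j} → Walk G a b L → Walk G a c j → Walk G b c (L + j)
      go [ a ] acc = acc
      go {L = suc L} {j} (e ∷ w) acc = subst (Walk G _ _) (+-suc L j) (go w (adj-sym e ∷ acc))

-- Every convex set containing T contains a geodetic set S, hence all of V:
-- a geodetic set inside the hull of T makes T a hull set.
geodetic⇒hull : ∀ (G : Graph) {S T} → Geodetic G S → (∀ u → u ∈ S → InHull G T u) → HullSet G T
geodetic⇒hull G geo S⊆hull v P convex T⊆P with geo v
... | u , w , u∈S , w∈S , v∈I = convex u w v (S⊆hull u u∈S P convex T⊆P) (S⊆hull w w∈S P convex T⊆P) v∈I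

-- The strong product K_m ⊠ C_n with n = 2k+1 and m = m'+2.  The second
-- coordinate of a vertex is its position on the cycle; the vertices at one
-- position form a fibre (a copy of K_m).  Adjacent vertices
-- have positions at most one step apart and any two vertices in distinct
-- fibres are joined by a walk following the shorter arc, so the distance
-- between vertices in distinct fibres is the cycle distance of their
-- positions; consequently intervals project onto betweenness in C_n.
module Product (k : ℕ) (2≤k : 2 ≤ k) (m' : ℕ) where

  n : ℕ
  n = suc (2 * k)

  open OddCycle n k refl 2≤k public

  m : ℕ
  m = suc (suc m')

  G : Graph
  G = K m ⊠ C n

  open Walks G

  Vertex : Set
  Vertex = Fin m × Fin n

  pos : Vertex → ℕ
  pos v = toℕ (proj₂ v)

  pos<n : ∀ v → pos v < n
  pos<n v = FinProps.toℕ<n (proj₂ v)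

  _≟V_ : (x y : Vertex) → Dec (x ≡ y)
  _≟V_ = ≡-dec FinProps._≟_ FinProps._≟_

  nextF : Fin n → Fin n
  nextF a = fromℕ< (next<n (FinProps.toℕ<n a))

  toℕ-nextF : ∀ a → toℕ (nextF a) ≡ next (toℕ a)
  toℕ-nextF a = FinProps.toℕ-fromℕ< (next<n (FinProps.toℕ<n a))

  cycle-step : ∀ (a b : Fin n) → toℕ b ≡ next (toℕ a) → CAdj n a b
  cycle-step a b hb with next-cases (toℕ a)
  ... | inj₁ (e , e0) = inj₂ (inj₂ (inj₂ (trans hb e0 , e)))
  ... | inj₂ (_ , es) = inj₁ (sym (trans hb es))

  forward-step : ∀ (i j : Fin m) (a b : Fin n) → toℕ b ≡ next (toℕ a) → Adj G (i , a) (j , b)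
  forward-step i j a b hb with i FinProps.≟ j
  ... | yes refl = inj₁ (refl , cycle-step a b hb)
  ... | no i≢j = inj₂ (inj₂ (i≢j , cycle-step a b hb))

  cycle-step-cases : ∀ {a b : Fin n} → CAdj n a b → toℕ b ≡ next (toℕ a) ⊎ toℕ a ≡ next (toℕ b)
  cycle-step-cases {a} {b} (inj₁ e) with next-cases (toℕ a)
  ... | inj₁ (sa≡n , _) = ⊥-elim (<-irrefl (trans (sym e) sa≡n) (FinProps.toℕ<n b))
  ... | inj₂ (_ , es) = inj₁ (trans (sym e) (sym es))
  cycle-step-cases {a} {b} (inj₂ (inj₁ e)) with next-cases (toℕ b)
  ... | inj₁ (sb≡n , _) = ⊥-elim (<-irrefl (trans (sym e) sb≡n) (FinProps.toℕ<n a))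
  ... | inj₂ (_ , es) = inj₂ (trans (sym e) (sym es))
  cycle-step-cases {a} {b} (inj₂ (inj₂ (inj₁ (a≡0 , sb≡n)))) with next-cases (toℕ b)
  ... | inj₁ (_ , e0) = inj₂ (trans a≡0 (sym e0))
  ... | inj₂ (sb≢n , _) = ⊥-elim (sb≢n sb≡n)
  cycle-step-cases {a} {b} (inj₂ (inj₂ (inj₂ (b≡0 , sa≡n)))) with next-cases (toℕ a)
  ... | inj₁ (_ , e0) = inj₁ (trans b≡0 (sym e0))
  ... | inj₂ (sa≢n , _) = ⊥-elim (sa≢n sa≡n)

  cadj-sym : ∀ {a b : Fin n} → CAdj n a b → CAdj n b a
  cadj-sym (inj₁ e) = inj₂ (inj₁ e)
  cadj-sym (inj₂ (inj₁ e)) = inj₁ e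
  cadj-sym (inj₂ (inj₂ (inj₁ e))) = inj₂ (inj₂ (inj₂ e))
  cadj-sym (inj₂ (inj₂ (inj₂ e))) = inj₂ (inj₂ (inj₁ e))

  adj-sym : ∀ {x y : Vertex} → Adj G x y → Adj G y x
  adj-sym (inj₁ (e , c)) = inj₁ (sym e , cadj-sym c)
  adj-sym (inj₂ (inj₁ (e , i≢j))) = inj₂ (inj₁ (sym e , i≢j ∘ sym))
  adj-sym (inj₂ (inj₂ (i≢j , c))) = inj₂ (inj₂ (i≢j ∘ sym , cadj-sym c))

  adj-pos : ∀ {x y : Vertex} → Adj G x y → pos x ≡ pos y ⊎ pos y ≡ next (pos x) ⊎ pos x ≡ next (pos y)
  adj-pos (inj₁ (_ , c)) = inj₂ (cycle-step-cases c)
  adj-pos (inj₂ (inj₁ (e , _))) = inj₁ (cong toℕ e)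
  adj-pos (inj₂ (inj₂ (_ , c))) = inj₂ (cycle-step-cases c)

  walk-lower : ∀ {x y L} → Walk G x y L → cdist (pos x) (pos y) ≤ L
  walk-lower [ x ] = ≡⇒≤ (cdist-self (pos<n x))
  walk-lower {x} {y} (_∷_ {y = z} e w) with adj-pos e
  ... | inj₁ eq = ≤-trans (≡⇒≤ (cong (λ t → cdist t (pos y)) eq)) (≤-trans (walk-lower w) (n≤1+n _))
  ... | inj₂ (inj₁ eq) =
    ≤-trans (proj₂ (cdist-next (pos<n x) (pos<n y))) (s≤s (≤-trans (≡⇒≥ (cong (λ t → cdist t (pos y)) eq)) (walk-lower w)))
  ... | inj₂ (inj₂ eq) =
    ≤-trans (≡⇒≤ (cong (λ t → cdist t (pos y)) eq)) (≤-trans (proj₁ (cdist-next (pos<n z) (pos<n y))) (s≤s (walk-lower w)))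

  forward-walk : ∀ t (x y : Vertex) → fwd (pos x) (pos y) ≡ suc t → Walk G x y (suc t)
  forward-walk zero x y e =
    forward-step (proj₁ x) (proj₁ y) (proj₂ x) (proj₂ y)
      (fwd-injective (pos<n x) (pos<n y) (next<n (pos<n x)) (trans e (sym (fwd-next (pos<n x))))) ∷ [ y ]
  forward-walk (suc t) x y e =
    forward-step (proj₁ x) (proj₁ y) (proj₂ x) (nextF (proj₂ x)) (toℕ-nextF (proj₂ x)) ∷ forward-walk t z y e'
    where
    z : Vertex
    z = proj₁ y , nextF (proj₂ x)
    x≢y : pos x ≢ pos y
    x≢y eq = 0≢1+n (trans (sym (fwd-self (pos<n x))) (trans (cong (fwd (pos x)) eq) e))
    e' : fwd (pos z) (pos y) ≡ suc t
    e' = suc-injective (trans (sym (trans (fwd-from-next (pos<n x) (pos<n y) x≢y)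
                                          (cong (λ u → suc (fwd u (pos y))) (sym (toℕ-nextF (proj₂ x)))))) e)

  forward-walk' : ∀ {x y} → pos x ≢ pos y → Walk G x y (fwd (pos x) (pos y))
  forward-walk' {x} {y} x≢y = go _ refl (fwd-pos (pos<n x) (pos<n y) x≢y)
    where go : ∀ f → fwd (pos x) (pos y) ≡ f → 1 ≤ f → Walk G x y f
          go (suc t) e _ = forward-walk t x y e

  shortest-walk : ∀ {x y} → pos x ≢ pos y → Walk G x y (cdist (pos x) (pos y))
  shortest-walk {x} {y} x≢y with ⊓-sel (fwd (pos x) (pos y)) (fwd (pos y) (pos x))
  ... | inj₁ e = subst (Walk G x y) (sym e) (forward-walk' x≢y)
  ... | inj₂ e = subst (Walk G x y) (sym e) (reverse adj-sym (forward-walk' (x≢y ∘ sym)))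

  fibre-walk : ∀ {x y} → x ≢ y → pos x ≡ pos y → Walk G x y 1
  fibre-walk {i , a} {j , b} x≢y e =
    inj₂ (inj₁ (FinProps.toℕ-injective e , λ i≡j → x≢y (cong₂ _,_ i≡j (FinProps.toℕ-injective e)))) ∷ [ _ ]

  fibre-dist : ∀ {x y d} → (∀ L → Walk G x y L → d ≤ L) → pos x ≡ pos y → d ≤ 1
  fibre-dist {x} {y} shortest e with x ≟V y
  ... | yes refl = ≤-trans (shortest 0 [ x ]) z≤n
  ... | no x≢y = shortest 1 (fibre-walk x≢y e)

  no-shortcut : ∀ {L₁ L₂ d X Y} → X ≤ L₁ → Y ≤ L₂ → L₁ + L₂ ≡ d → d < X + Y → ⊥
  no-shortcut h₁ h₂ sum d<X+Y = <⇒≱ d<X+Y (≤-trans (h₁ ⊕ h₂) (≡⇒≤ sum))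

  inside-geodesic : ∀ {x y z d L₁ L₂} → (∀ L → Walk G x y L → d ≤ L) → L₁ + L₂ ≡ d →
                    Walk G x z L₁ → Walk G z y L₂ → z ≢ x → z ≢ y → Bet (pos x) (pos z) (pos y)
  inside-geodesic {x} {y} {z} shortest sum w₁ w₂ z≢x z≢y with pos x ≟ pos y
  ... | yes same = ⊥-elim (no-shortcut (walk-pos w₁ (z≢x ∘ sym)) (walk-pos w₂ z≢y) sum (s≤s (fibre-dist shortest same)))
  ... | no differ with pos z ≟ pos x | pos z ≟ pos y
  ...   | yes zx | _ =
    ⊥-elim (no-shortcut (walk-pos w₁ (z≢x ∘ sym)) (subst (λ t → cdist t (pos y) ≤ _) zx (walk-lower w₂)) sum
                        (s≤s (shortest _ (shortest-walk differ))))
  ...   | no _ | yes zy =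
    ⊥-elim (no-shortcut (subst (λ t → cdist (pos x) t ≤ _) zy (walk-lower w₁)) (walk-pos w₂ z≢y) sum
                        (≤-trans (s≤s (shortest _ (shortest-walk differ))) (≡⇒≤ (+-comm 1 _))))
  ...   | no zx | no zy =
    (zx ∘ sym) , zy , ≤-trans (walk-lower w₁ ⊕ walk-lower w₂) (≤-trans (≡⇒≤ sum) (shortest _ (shortest-walk differ)))

  interval-projects : ∀ {x y z} → InInterval G x y z → z ≡ x ⊎ z ≡ y ⊎ Bet (pos x) (pos z) (pos y)
  interval-projects {x} {y} {z} (d , (_ , shortest) , w , z∈w) with z ≟V x | z ≟V y
  ... | yes e | _ = inj₁ e
  ... | no _ | yes e = inj₂ (inj₁ e)
  ... | no z≢x | no z≢y with split w z∈w
  ...   | L₁ , L₂ , sum , w₁ , w₂ = inj₂ (inj₂ (inside-geodesic shortest sum w₁ w₂ z≢x z≢y))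

  -- Conversely, walking forward along an arc of length at most k is a
  -- geodesic, so every vertex whose position is on that arc is in the interval.
  on-short-arc : ∀ {u v w} → pos u ≢ pos v → pos v ≢ pos w →
                 fwd (pos u) (pos v) + fwd (pos v) (pos w) ≤ k → InInterval G u w v
  on-short-arc {u} {v} {w} u≢v v≢w short =
    _ , (w₁ ++ w₂ , shortest) , w₁ ++ w₂ , on-junction w₁ w₂
    where
    w₁ = forward-walk' u≢v
    w₂ = forward-walk' v≢w
    shortest : ∀ L → Walk G u w L → fwd (pos u) (pos v) + fwd (pos v) (pos w) ≤ L
    shortest L w' = ≤-trans (short-arc (pos<n u) (pos<n v) (pos<n w) u≢v short) (walk-lower w')

  geodesic-inside : ∀ {u v w a c} → pos u ≡ a → pos w ≡ c → a < pos v → pos v < c → c ≤ k + a →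
                    InInterval G u w v
  geodesic-inside {w = w} refl refl a<v v<c c≤ =
    on-short-arc (<⇒≢ a<v) (<⇒≢ v<c) (route-inside a<v v<c (pos<n w) c≤)

  geodesic-wrap-after : ∀ {u v w a c} → pos u ≡ a → pos w ≡ c → c < a → a < pos v → n + c ≤ k + a →
                        InInterval G u w v
  geodesic-wrap-after {v = v} refl refl c<a a<v far =
    on-short-arc (<⇒≢ a<v) (<⇒≢ (<-trans c<a a<v) ∘ sym) (route-wrap-after c<a a<v (pos<n v) far)

  geodesic-wrap-before : ∀ {u v w a c} → pos u ≡ a → pos w ≡ c → pos v < c → c < a → n + c ≤ k + a →
                         InInterval G u w v
  geodesic-wrap-before {u = u} refl refl v<c c<a far =
    on-short-arc (<⇒≢ (<-trans v<c c<a) ∘ sym) (<⇒≢ v<c) (route-wrap-before v<c c<a (pos<n u) far)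

  at : (t : ℕ) → t < n → Vertex
  at t h = fzero , fromℕ< h

  pos-at : ∀ {t} (t<n : t < n) → pos (at t t<n) ≡ t
  pos-at t<n = FinProps.toℕ-fromℕ< t<n

  v₀ v₁ vₖ vₖ₊₁ v₂ₖ : Vertex
  v₀ = at 0 z<s
  v₁ = at 1 1<n
  vₖ = at k k<n
  vₖ₊₁ = at (suc k) k+1<n
  v₂ₖ = at (2 * k) 2k<n

  pos-v₀ : pos v₀ ≡ 0
  pos-v₀ = refl
  pos-v₁ : pos v₁ ≡ 1
  pos-v₁ = pos-at 1<n
  pos-vₖ : pos vₖ ≡ k
  pos-vₖ = pos-at k<n
  pos-vₖ₊₁ : pos vₖ₊₁ ≡ suc k
  pos-vₖ₊₁ = pos-at k+1<n
  pos-v₂ₖ : pos v₂ₖ ≡ 2 * k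
  pos-v₂ₖ = pos-at 2k<n

  apart : ∀ {x y a b} → pos x ≡ a → pos y ≡ b → a < b → x ≢ y
  apart px py a<b x≡y = <⇒≢ a<b (trans (sym px) (trans (cong pos x≡y) py))

  five : List Vertex
  five = v₀ ∷ v₁ ∷ vₖ ∷ vₖ₊₁ ∷ v₂ₖ ∷ []

  three : List Vertex
  three = v₀ ∷ vₖ ∷ vₖ₊₁ ∷ []

  five-unique : Unique five
  five-unique =
    (apart pos-v₀ pos-v₁ z<s ∷ apart pos-v₀ pos-vₖ 0<k ∷ apart pos-v₀ pos-vₖ₊₁ z<s ∷ apart pos-v₀ pos-v₂ₖ (<-trans 0<k k<2k) ∷ []) ∷
    (apart pos-v₁ pos-vₖ 2≤k ∷ apart pos-v₁ pos-vₖ₊₁ (<-trans 2≤k (n<1+n k)) ∷ apart pos-v₁ pos-v₂ₖ (<-trans 2≤k k<2k) ∷ []) ∷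
    (apart pos-vₖ pos-vₖ₊₁ (n<1+n k) ∷ apart pos-vₖ pos-v₂ₖ k<2k ∷ []) ∷
    (apart pos-vₖ₊₁ pos-v₂ₖ k+1<2k ∷ []) ∷ [] ∷ []
    where 0<k = <-trans z<s 2≤k

  three-unique : Unique three
  three-unique =
    (apart pos-v₀ pos-vₖ (<-trans z<s 2≤k) ∷ apart pos-v₀ pos-vₖ₊₁ z<s ∷ []) ∷ (apart pos-vₖ pos-vₖ₊₁ (n<1+n k) ∷ []) ∷ [] ∷ []

  -- Every vertex lies on a geodesic between two of the five landmarks:
  -- position 0 on the arc 2k → 1, positions in (0, k) on 0 → k, position k
  -- on 1 → k+1, positions in (k, 2k) on k → 2k and the rest on k+1 → 0.
  five-geodetic : Geodetic G five
  five-geodetic v with pos v ≟ 0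
  ... | yes v≡0 =
    v₂ₖ , v₁ , there (there (there (there (here refl)))) , there (here refl) ,
    geodesic-wrap-before pos-v₂ₖ pos-v₁ (subst (_< 1) (sym v≡0) z<s) (<-trans 2≤k k<2k) wrap-to-1
  ... | no v≢0 with pos v <? k
  ...   | yes v<k =
    v₀ , vₖ , here refl , there (there (here refl)) ,
    geodesic-inside pos-v₀ pos-vₖ (n≢0⇒n>0 v≢0) v<k (m≤m+n k 0)
  ...   | no v≮k with pos v ≟ k
  ...     | yes v≡k =
    v₁ , vₖ₊₁ , there (here refl) , there (there (there (here refl))) ,
    geodesic-inside pos-v₁ pos-vₖ₊₁ (subst (1 <_) (sym v≡k) 2≤k) (subst (_< suc k) (sym v≡k) (n<1+n k)) (≡⇒≥ (+-comm k 1))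
  ...     | no v≢k with pos v <? 2 * k
  ...       | yes v<2k =
    vₖ , v₂ₖ , there (there (here refl)) , there (there (there (there (here refl)))) ,
    geodesic-inside pos-vₖ pos-v₂ₖ (≤∧≢⇒< (≮⇒≥ v≮k) (v≢k ∘ sym)) v<2k (≡⇒≤ (cong (k +_) (+-identityʳ k)))
  ...       | no v≮2k =
    vₖ₊₁ , v₀ , there (there (there (here refl))) , here refl ,
    geodesic-wrap-after pos-vₖ₊₁ pos-v₀ z<s (<-≤-trans k+1<2k (≮⇒≥ v≮2k)) wrap-to-0

  -- Every convex set containing the three landmarks 0, k, k+1 contains the
  -- five (1 lies on the arc 0 → k, and 2k on k+1 → 0), hence everything.
  three-hull : HullSet G three
  three-hull = geodetic⇒hull G five-geodetic generated
    where
    generated : ∀ u → u ∈ five → InHull G three u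
    generated u (here refl) P convex ⊇three = ⊇three v₀ (here refl)
    generated u (there (here refl)) P convex ⊇three =
      convex v₀ vₖ v₁ (⊇three v₀ (here refl)) (⊇three vₖ (there (here refl)))
        (geodesic-inside pos-v₀ pos-vₖ (subst (0 <_) (sym pos-v₁) z<s) (subst (_< k) (sym pos-v₁) 2≤k) (m≤m+n k 0))
    generated u (there (there (here refl))) P convex ⊇three = ⊇three vₖ (there (here refl))
    generated u (there (there (there (here refl)))) P convex ⊇three = ⊇three vₖ₊₁ (there (there (here refl)))
    generated u (there (there (there (there (here refl))))) P convex ⊇three =
      convex vₖ₊₁ v₀ v₂ₖ (⊇three vₖ₊₁ (there (there (here refl)))) (⊇three v₀ (here refl))
        (geodesic-wrap-after pos-vₖ₊₁ pos-v₀ z<s (subst (suc k <_) (sym pos-v₂ₖ) k+1<2k) wrap-to-0)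

module LowerBounds (k : ℕ) (2≤k : 2 ≤ k) (m' : ℕ) where

  open Product k 2≤k m'

  pullback-convex : ∀ {Q} → BetClosed Q → Convex G (Q ∘ pos)
  pullback-convex closed x y z Qx Qy z∈I with interval-projects z∈I
  ... | inj₁ refl = Qx
  ... | inj₂ (inj₁ refl) = Qy
  ... | inj₂ (inj₂ bt) = closed (pos<n x) (pos<n z) (pos<n y) Qx Qy bt

  -- Sets of at most two vertices are not hull sets: their positions lie in
  -- a convex set of C_n missing some position d, whose pullback is convex.
  pair-not-hull : ∀ {S} x y → (∀ u → u ∈ S → u ≡ x ⊎ u ≡ y) → ¬ HullSet G S
  pair-not-hull {S} x y S⊆ hull with pair-blocked (pos<n x) (pos<n y)
  ... | Q , closed , Qx , Qy , d , d<n , ¬Qd =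
    ¬Qd (subst Q (pos-at d<n) (hull (at d d<n) (Q ∘ pos) (pullback-convex closed) S⊆Q))
    where
    S⊆Q : ∀ u → u ∈ S → Q (pos u)
    S⊆Q u u∈S with S⊆ u u∈S
    ... | inj₁ refl = Qx
    ... | inj₂ refl = Qy

  hull-lower : ∀ S → HullSet G S → 3 ≤ length S
  hull-lower [] = ⊥-elim ∘ pair-not-hull v₀ v₀ (λ _ ())
  hull-lower (a ∷ []) = ⊥-elim ∘ pair-not-hull a a (λ { _ (here refl) → inj₁ refl })
  hull-lower (a ∷ b ∷ []) =
    ⊥-elim ∘ pair-not-hull a b (λ { _ (here refl) → inj₁ refl ; _ (there (here refl)) → inj₂ refl })
  hull-lower (_ ∷ _ ∷ _ ∷ _) _ = s≤s (s≤s (s≤s z≤n))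

  Image : (Vertex → Set) → ℕ → Set
  Image X c = Σ Vertex λ u → X u × pos u ≡ c

  image-<n : ∀ {X c} → Image X c → c < n
  image-<n (u , _ , refl) = pos<n u

  -- What a geodetic set gives after projection to the cycle: every vertex
  -- is in X or has its position strictly between two positions of X.
  -- Covering is inherited by supersets.
  Covers : (Vertex → Set) → Set
  Covers X = ∀ v → X v ⊎ Inner (Image X) (pos v)

  geodetic-covers : ∀ {S} → Geodetic G S → Covers (_∈ S)
  geodetic-covers geo v with geo v
  ... | u , w , u∈S , w∈S , v∈I with interval-projects v∈I
  ...   | inj₁ refl = inj₁ u∈S
  ...   | inj₂ (inj₁ refl) = inj₁ w∈S
  ...   | inj₂ (inj₂ bt) = inj₂ (pos u , pos w , (u , u∈S , refl) , (w , w∈S , refl) , bt)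

  Covers-mono : ∀ {X Y} → (∀ {u} → X u → Y u) → Covers X → Covers Y
  Covers-mono X⊆Y cov v with cov v
  ... | inj₁ Xv = inj₁ (X⊆Y Xv)
  ... | inj₂ (a , b , (u , Xu , pu) , (w , Xw , pw) , bt) = inj₂ (a , b , (u , X⊆Y Xu , pu) , (w , X⊆Y Xw , pw) , bt)

  blocked-cover : ∀ {X Q d} → BetClosed Q → (∀ {c} → Image X c → Q c) → d < n → ¬ Q d → ¬ Covers X
  blocked-cover {X} {Q} {d} closed X⊆Q d<n ¬Qd cov with cov (at d d<n)
  ... | inj₁ X-at = ¬Qd (X⊆Q (at d d<n , X-at , pos-at d<n))
  ... | inj₂ (a , b , Ia , Ib , bt) =
    ¬Qd (closed (image-<n Ia) d<n (image-<n Ib) (X⊆Q Ia) (X⊆Q Ib) (subst (λ t → Bet a t b) (pos-at d<n) bt))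

  two-positions : ∀ {X a b} → a < n → b < n → (∀ {c} → Image X c → c ≡ a ⊎ c ≡ b) → ¬ Covers X
  two-positions {X} a<n b<n X⊆ with pair-blocked a<n b<n
  ... | Q , closed , Qa , Qb , d , d<n , ¬Qd = blocked-cover closed X⊆Q d<n ¬Qd
    where
    X⊆Q : ∀ {c} → Image X c → Q c
    X⊆Q Ic with X⊆ Ic
    ... | inj₁ refl = Qa
    ... | inj₂ refl = Qb

  -- A second vertex in the fibre of v (here m ≥ 2 is used): it differs
  -- from v and has the same position.
  mate : Vertex → Vertex
  mate (fzero , a) = fsuc fzero , a
  mate (fsuc _ , a) = fzero , a

  mate-≢ : ∀ v → mate v ≢ v
  mate-≢ (fzero , a) ()
  mate-≢ (fsuc _ , a) ()

  mate-pos : ∀ v → pos (mate v) ≡ pos v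
  mate-pos (fzero , a) = refl
  mate-pos (fsuc _ , a) = refl

  -- A vertex of X alone at its position has that position inner to X,
  -- because its mate (same position, not in X) must be covered.
  lonely-inner : ∀ {X x} → Covers X → (∀ {y} → X y → pos y ≡ pos x → y ≡ x) → Inner (Image X) (pos x)
  lonely-inner {X} {x} cov alone with cov (mate x)
  ... | inj₁ X-mate = ⊥-elim (mate-≢ x (alone X-mate (mate-pos x)))
  ... | inj₂ inner = subst (Inner (Image X)) (mate-pos x) inner

  slot-image : ∀ {x₁ x₂ x₃ x₄ c} → Image (In4 x₁ x₂ x₃ x₄) c → In4 (pos x₁) (pos x₂) (pos x₃) (pos x₄) c
  slot-image {x₁} {x₂} {x₃} {x₄} (u , slot , refl) =
    In4-elim (λ u → In4 (pos x₁) (pos x₂) (pos x₃) (pos x₄) (pos u)) 1st 2nd 3rd 4th slot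

  alone : ∀ {x₁ x₂ x₃ x₄} → pos x₂ ≢ pos x₁ → pos x₃ ≢ pos x₁ → pos x₄ ≢ pos x₁ →
          ∀ {y} → In4 x₁ x₂ x₃ x₄ y → pos y ≡ pos x₁ → y ≡ x₁
  alone {x₁} n₂ n₃ n₄ = In4-elim (λ y → pos y ≡ pos x₁ → y ≡ x₁) (λ _ → refl) (⊥-elim ∘ n₂) (⊥-elim ∘ n₃) (⊥-elim ∘ n₄)

  -- Two slots at one position: at most three positions are occupied; if
  -- only two, they are blocked, and if three, the two positions occupied
  -- once would each lie between the other two.
  shared-position : ∀ {x₁ x₂ x₃ x₄} → pos x₂ ≡ pos x₁ → ¬ Covers (In4 x₁ x₂ x₃ x₄)
  shared-position {x₁} {x₂} {x₃} {x₄} e₂ cov with pos x₃ ≟ pos x₁ | pos x₄ ≟ pos x₁ | pos x₃ ≟ pos x₄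
  ... | yes e₃ | _ | _ =
    two-positions (pos<n x₁) (pos<n x₄) (In4-elim (λ c → c ≡ pos x₁ ⊎ c ≡ pos x₄) (inj₁ refl) (inj₁ e₂) (inj₁ e₃) (inj₂ refl) ∘ slot-image) cov
  ... | no _ | yes e₄ | _ =
    two-positions (pos<n x₁) (pos<n x₃) (In4-elim (λ c → c ≡ pos x₁ ⊎ c ≡ pos x₃) (inj₁ refl) (inj₁ e₂) (inj₂ refl) (inj₁ e₄) ∘ slot-image) cov
  ... | no _ | no _ | yes e₃₄ =
    two-positions (pos<n x₁) (pos<n x₃) (In4-elim (λ c → c ≡ pos x₁ ⊎ c ≡ pos x₃) (inj₁ refl) (inj₁ e₂) (inj₂ refl) (inj₂ (sym e₃₄)) ∘ slot-image) cov
  ... | no n₃ | no n₄ | no n₃₄ = Bet-exclusive (pos<n x₃) (pos<n x₄) x₃-between x₄-between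
    where
    x₃-between : Bet (pos x₁) (pos x₃) (pos x₄)
    x₃-between =
      inner-of-three (pos<n x₁) (pos<n x₄) (pos<n x₃)
        (In4-elim (λ c → c ≡ pos x₁ ⊎ c ≡ pos x₄ ⊎ c ≡ pos x₃) (inj₁ refl) (inj₁ e₂) (inj₂ (inj₂ refl)) (inj₂ (inj₁ refl)) ∘ slot-image)
        (lonely-inner cov (alone (n₃ ∘ sym) (λ h → n₃ (trans (sym h) e₂)) (n₃₄ ∘ sym) ∘ In4-elim (In4 _ _ _ _) 2nd 3rd 1st 4th))
    x₄-between : Bet (pos x₁) (pos x₄) (pos x₃)
    x₄-between =
      inner-of-three (pos<n x₁) (pos<n x₃) (pos<n x₄)
        (In4-elim (λ c → c ≡ pos x₁ ⊎ c ≡ pos x₃ ⊎ c ≡ pos x₄) (inj₁ refl) (inj₁ e₂) (inj₂ (inj₁ refl)) (inj₂ (inj₂ refl)) ∘ slot-image)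
        (lonely-inner cov (alone (n₄ ∘ sym) (λ h → n₄ (trans (sym h) e₂)) n₃₄ ∘ In4-elim (In4 _ _ _ _) 2nd 3rd 4th 1st))

  -- Four slots at four distinct positions: every position is occupied once,
  -- so all four would be inner.
  all-apart : ∀ {x₁ x₂ x₃ x₄} → pos x₂ ≢ pos x₁ → pos x₃ ≢ pos x₁ → pos x₄ ≢ pos x₁ →
              pos x₃ ≢ pos x₂ → pos x₄ ≢ pos x₂ → pos x₄ ≢ pos x₃ → ¬ Covers (In4 x₁ x₂ x₃ x₄)
  all-apart {x₁} {x₂} {x₃} {x₄} n₁₂ n₁₃ n₁₄ n₂₃ n₂₄ n₃₄ cov =
    four-not-inner (pos<n x₁) (pos<n x₂) (pos<n x₃) (pos<n x₄)
      (n₂₃ ∘ sym) (n₂₄ ∘ sym) (n₃₄ ∘ sym) slot-image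
      (lonely-inner cov (alone n₁₂ n₁₃ n₁₄))
      (lonely-inner cov (alone (n₁₂ ∘ sym) n₂₃ n₂₄ ∘ In4-elim (In4 _ _ _ _) 2nd 1st 3rd 4th))
      (lonely-inner cov (alone (n₁₃ ∘ sym) (n₂₃ ∘ sym) n₃₄ ∘ In4-elim (In4 _ _ _ _) 2nd 3rd 1st 4th))
      (lonely-inner cov (alone (n₁₄ ∘ sym) (n₂₄ ∘ sym) (n₃₄ ∘ sym) ∘ In4-elim (In4 _ _ _ _) 2nd 3rd 4th 1st))

  four-not-cover : ∀ x₁ x₂ x₃ x₄ → ¬ Covers (In4 x₁ x₂ x₃ x₄)
  four-not-cover x₁ x₂ x₃ x₄ cov with pos x₂ ≟ pos x₁
  ... | yes e = shared-position e cov
  ... | no n₁₂ with pos x₃ ≟ pos x₁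
  ...   | yes e = shared-position e (Covers-mono (In4-elim (In4 _ _ _ _) 1st 3rd 2nd 4th) cov)
  ...   | no n₁₃ with pos x₄ ≟ pos x₁
  ...     | yes e = shared-position e (Covers-mono (In4-elim (In4 _ _ _ _) 1st 3rd 4th 2nd) cov)
  ...     | no n₁₄ with pos x₃ ≟ pos x₂
  ...       | yes e = shared-position e (Covers-mono (In4-elim (In4 _ _ _ _) 3rd 1st 2nd 4th) cov)
  ...       | no n₂₃ with pos x₄ ≟ pos x₂
  ...         | yes e = shared-position e (Covers-mono (In4-elim (In4 _ _ _ _) 3rd 1st 4th 2nd) cov)
  ...         | no n₂₄ with pos x₄ ≟ pos x₃
  ...           | yes e = shared-position e (Covers-mono (In4-elim (In4 _ _ _ _) 3rd 4th 1st 2nd) cov)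
  ...           | no n₃₄ = all-apart n₁₂ n₁₃ n₁₄ n₂₃ n₂₄ n₃₄ cov

  geodetic-lower : ∀ S → Geodetic G S → 5 ≤ length S
  geodetic-lower [] geo with geo v₀
  ... | _ , _ , () , _
  geodetic-lower (a ∷ []) geo = ⊥-elim (four-not-cover a a a a (Covers-mono slots (geodetic-covers geo)))
    where slots : ∀ {u} → u ∈ a ∷ [] → In4 a a a a u
          slots (here refl) = 1st
  geodetic-lower (a ∷ b ∷ []) geo = ⊥-elim (four-not-cover a b b b (Covers-mono slots (geodetic-covers geo)))
    where slots : ∀ {u} → u ∈ a ∷ b ∷ [] → In4 a b b b u
          slots (here refl) = 1st
          slots (there (here refl)) = 2nd
  geodetic-lower (a ∷ b ∷ c ∷ []) geo = ⊥-elim (four-not-cover a b c c (Covers-mono slots (geodetic-covers geo)))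
    where slots : ∀ {u} → u ∈ a ∷ b ∷ c ∷ [] → In4 a b c c u
          slots (here refl) = 1st
          slots (there (here refl)) = 2nd
          slots (there (there (here refl))) = 3rd
  geodetic-lower (a ∷ b ∷ c ∷ d ∷ []) geo = ⊥-elim (four-not-cover a b c d (Covers-mono slots (geodetic-covers geo)))
    where slots : ∀ {u} → u ∈ a ∷ b ∷ c ∷ d ∷ [] → In4 a b c d u
          slots (here refl) = 1st
          slots (there (here refl)) = 2nd
          slots (there (there (here refl))) = 3rd
          slots (there (there (there (here refl)))) = 4th
  geodetic-lower (_ ∷ _ ∷ _ ∷ _ ∷ _ ∷ _) _ = s≤s (s≤s (s≤s (s≤s (s≤s z≤n))))

2≤k-of : ∀ k → 5 ≤ suc (2 * k) → 2 ≤ k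
2≤k-of zero (s≤s ())
2≤k-of (suc zero) (s≤s (s≤s (s≤s ())))
2≤k-of (suc (suc j)) _ = s≤s (s≤s z≤n)

-- The five landmarks are a geodetic set and the three a hull set (of
-- distinct vertices), and the lower bounds hold even without distinctness.
proposition8 : (n m : ℕ) → 5 ≤ n → (∃ λ k → n ≡ suc (2 * k)) → 2 ≤ m →
    GeodeticNumber (K m ⊠ C n) 5 × HullNumber (K m ⊠ C n) 3
proposition8 _ (suc (suc m')) 5≤n (k , refl) (s≤s (s≤s z≤n)) =
  ((five , five-unique , refl , five-geodetic) , λ S _ → geodetic-lower S) ,
  ((three , three-unique , refl , three-hull) , λ S _ → hull-lower S)
  where
  open Product k (2≤k-of k 5≤n) m'
  open LowerBounds k (2≤k-of k 5≤n) m'
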